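{- Let $G$ be a graph, let $F=(\iota,\tau)$ be a $k$-flip on $V(G)$, and let $I$ be an independent set of $G$ containing exactly one element of each $F$-class. Then there exist $z_1,\dots,z_p\in I$ with $p\le 3k/2$, where each element of $I$ occurs at most twice in the sequence, such that $G\oplus F\ast z_1\ast\dots\ast z_p-N_G[I]=G-N_G[I]$, where $N_G[I]$ is the closed neighbourhood of $I$ in $G$.
   Context: Graphs are finite and simple; adjacency $E_G(u,v)\in\mathrm{GF}(2)$. A $k$-flip on $V$ is $F=(\iota,\tau)$ with $\iota:V\to[k]$ and $\tau:[k]\times[k]\to\mathrm{GF}(2)$ symmetric; $G\oplus F$ has $E_{G\oplus F}(x,y)=E_G(x,y)+\tau(\iota(x),\iota(y))$ for distinct $x,y$; the $F$-classes are the sets $\iota^{ -1}(i)$. For a vertex $v$, $E_{G\ast v}(x,y)=E_G(x,y)+E_G(x,v)E_G(v,y)$. $H-D$ denotes the induced subgraph obtained by deleting $D$. Expressions are evaluated left to right. -}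

module Defs where

open import Data.Nat using (ℕ)
open import Data.Bool using (Bool; true; false; _xor_; _∧_; _∨_; if_then_else_)
open import Data.Fin using (Fin; _≟_)
open import Data.Fin.Subset using (Subset; _∈_; _∉_)
open import Data.Sum using (_⊎_)
open import Data.List using (List; filter; length; foldl)
open import Data.Product using (Σ; ∃; _×_; _,_)
open import Relation.Binary.PropositionalEquality using (_≡_)
open import Relation.Nullary using (¬_; yes; no)

-- A graph on vertex set Fin n, given by its adjacency E(u,v) ∈ GF(2),
-- where GF(2) is modelled by Bool with addition _xor_ and product _∧_.
Adj : ℕ → Set
Adj n = Fin n → Fin n → Bool

record IsSimple {n : ℕ} (E : Adj n) : Set where
  field
    sym   : ∀ x y → E x y ≡ E y x
    irref : ∀ x → E x x ≡ false

record Flip (n k : ℕ) : Set where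
  field
    ι    : Fin n → Fin k
    τ    : Fin k → Fin k → Bool
    τsym : ∀ i j → τ i j ≡ τ j i
open Flip public

_⊕_ : ∀ {n k} → Adj n → Flip n k → Adj n
(E ⊕ F) x y with x ≟ y
... | yes _ = false
... | no  _ = E x y xor τ F (ι F x) (ι F y)

_∗_ : ∀ {n} → Adj n → Fin n → Adj n
(E ∗ v) x y with x ≟ y
... | yes _ = false
... | no  _ = E x y xor (E x v ∧ E v y)

infixl 5 _⊕_ _∗_

Independent : ∀ {n} → Adj n → Subset n → Set
Independent E I = ∀ x y → x ∈ I → y ∈ I → E x y ≡ false

InClosedNbhd : ∀ {n} → Adj n → Subset n → Fin n → Set
InClosedNbhd E I x = x ∈ I ⊎ (∃ λ u → u ∈ I × E u x ≡ true)

SameOutside : ∀ {n} → (Fin n → Set) → Adj n → Adj n → Set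
SameOutside D H G = ∀ x y → ¬ D x → ¬ D y → H x y ≡ G x y

occ : ∀ {n} → Fin n → List (Fin n) → ℕ
occ v zs = length (filter (_≟ v) zs)

_∗*_ : ∀ {n} → Adj n → List (Fin n) → Adj n
E ∗* zs = foldl _∗_ E zs

{-# OPTIONS --safe #-}
-- Outside N_G[I], every graph reached from G ⊕ F by local complementations at
-- representatives v_i ∈ I of the classes is again G flipped by a symmetric
-- class matrix T, as long as each still active v_i sees an outside vertex x
-- exactly when T (ι x) i = 1: local complementation at v_j replaces T by
-- T + T(·,j) T(j,·). It therefore suffices to clear T. A class j with
-- T j j = 1 is cleared by one complementation at v_j, and an entry T a b = 1
-- with zero diagonal by the pivot v_a, v_b, v_a, which clears two classes.
-- Every class is retired at most once, at a cost of at most 3/2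
-- complementations per class.
module Submission where

open import Defs
open import Function using (_∘_)
open import Data.Nat using (ℕ; _≤_; _*_; _+_; z≤n; s≤s)
open import Data.Nat.Properties
  using (≤-refl; ≤-reflexive; ≤-trans; m≤n⇒m≤1+n; +-identityʳ; +-monoˡ-≤; +-monoʳ-≤; *-monoʳ-≤; *-distribˡ-+; module ≤-Reasoning)
open import Data.Bool using (Bool; true; false; _xor_; _∧_)
open import Data.Bool.Properties using (∧-comm; xor-assoc; xor-identityʳ; xor-same; ¬-not) renaming (_≟_ to _≟ᵇ_)
open import Data.Fin using (Fin; zero; suc; _≟_)
open import Data.Fin.Properties using (any?)
open import Data.Fin.Subset using (Subset; _∈_; _∉_; _⊆_; _⊂_; _-_; ⊤; ∣_∣; ⁅_⁆)
open import Data.Fin.Subset.Properties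
  using (∈⊤; _∈?_; ⊆-refl; ⊂-trans; p─q⊆p; x∈p∧x≢y⇒x∈p-y; x∈p⇒p-x⊂p; p⊂q⇒∣p∣<∣q∣; ∣⊤∣≡n)
open import Data.Fin.Subset.Induction using (Acc; acc; ⊂-wellFounded)
open import Data.Vec.Base as Vec using (there)
open import Data.List using (List; []; _∷_; _++_; length; map; filter)
open import Data.List.Properties using (length-map; length-++; length-filter; filter-++; filter-none; filter-reject)
open import Data.List.Relation.Unary.All as All using (All; []; _∷_)
open import Data.List.Relation.Unary.All.Properties using (map⁺)
open import Data.Product using (∃; _×_; _,_; proj₁; proj₂)
open import Data.Sum using (_⊎_; inj₁; inj₂; [_,_]′)
open import Relation.Binary.PropositionalEquality
  using (_≡_; _≢_; refl; sym; trans; cong; cong₂; subst; subst₂; module ≡-Reasoning)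
open import Relation.Nullary using (¬_; yes; no; contradiction)

private
  variable
    n k : ℕ

∗-diagonal : ∀ (H : Adj n) u x → (H ∗ u) x x ≡ false
∗-diagonal H u x with x ≟ x
... | yes _   = refl
... | no x≢x = contradiction refl x≢x

∗-apart : ∀ (H : Adj n) u {x y} → x ≢ y → (H ∗ u) x y ≡ H x y xor (H x u ∧ H u y)
∗-apart H u {x} {y} x≢y with x ≟ y
... | yes x≡y = contradiction x≡y x≢y
... | no _    = refl

⊕-diagonal : ∀ (H : Adj n) (F : Flip n k) x → (H ⊕ F) x x ≡ false
⊕-diagonal H F x with x ≟ x
... | yes _   = refl
... | no x≢x = contradiction refl x≢x

⊕-apart : ∀ (H : Adj n) (F : Flip n k) {x y} → x ≢ y → (H ⊕ F) x y ≡ H x y xor τ F (ι F x) (ι F y)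
⊕-apart H F {x} {y} x≢y with x ≟ y
... | yes x≡y = contradiction x≡y x≢y
... | no _    = refl

simple-from-apart : {H : Adj n} → (∀ x → H x x ≡ false) → (∀ {x y} → x ≢ y → H x y ≡ H y x) → IsSimple H
simple-from-apart {H = H} loopless symmetric-apart = record { sym = symmetric ; irref = loopless }
  where
  symmetric : ∀ x y → H x y ≡ H y x
  symmetric x y with x ≟ y
  ... | yes refl = refl
  ... | no x≢y   = symmetric-apart x≢y

∗-simple : {H : Adj n} → IsSimple H → ∀ u → IsSimple (H ∗ u)
∗-simple {H = H} simple u = simple-from-apart (∗-diagonal H u) λ {x} {y} x≢y → begin
  (H ∗ u) x y                ≡⟨ ∗-apart H u x≢y ⟩
  H x y xor (H x u ∧ H u y)  ≡⟨ cong₂ _xor_ (H-sym x y) (trans (cong₂ _∧_ (H-sym x u) (H-sym u y)) (∧-comm (H u x) (H y u))) ⟩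
  H y x xor (H y u ∧ H u x)  ≡⟨ sym (∗-apart H u (x≢y ∘ sym)) ⟩
  (H ∗ u) y x                ∎
  where
  open ≡-Reasoning
  H-sym = IsSimple.sym simple

⊕-simple : {H : Adj n} → IsSimple H → (F : Flip n k) → IsSimple (H ⊕ F)
⊕-simple {H = H} simple F = simple-from-apart (⊕-diagonal H F) λ {x} {y} x≢y → begin
  (H ⊕ F) x y                          ≡⟨ ⊕-apart H F x≢y ⟩
  H x y xor τ F (ι F x) (ι F y)        ≡⟨ cong₂ _xor_ (IsSimple.sym simple x y) (τsym F (ι F x) (ι F y)) ⟩
  H y x xor τ F (ι F y) (ι F x)        ≡⟨ sym (⊕-apart H F (x≢y ∘ sym)) ⟩
  (H ⊕ F) y x                          ∎
  where open ≡-Reasoning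

Matrix : ℕ → Set
Matrix k = Fin k → Fin k → Bool

Symmetric : Matrix k → Set
Symmetric T = ∀ a b → T a b ≡ T b a

SupportedOn : Subset k → Matrix k → Set
SupportedOn K T = ∀ a b → T a b ≡ true → a ∈ K

complementAt : Matrix k → Fin k → Matrix k
complementAt T j a b = T a b xor (T a j ∧ T j b)

x∉p-x : (p : Subset k) (x : Fin k) → x ∉ p - x
x∉p-x (_ Vec.∷ p) zero    ()
x∉p-x (_ Vec.∷ p) (suc x) (there x∈p-x) = x∉p-x p x x∈p-x

xor-∧-true : ∀ x y z → x xor (y ∧ z) ≡ true → x ≡ true ⊎ y ≡ true
xor-∧-true true  _    _ _  = inj₁ refl
xor-∧-true false true _ _  = inj₂ refl
xor-∧-true false false _ ()

complementAt-symmetric : ∀ {T : Matrix k} {j} → Symmetric T → Symmetric (complementAt T j)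
complementAt-symmetric {T = T} {j} T-sym a b =
  cong₂ _xor_ (T-sym a b) (trans (cong₂ _∧_ (T-sym a j) (T-sym j b)) (∧-comm (T j a) (T b j)))

complementAt-clears : ∀ {T : Matrix k} {j} → T j j ≡ true → ∀ b → complementAt T j j b ≡ false
complementAt-clears {T = T} {j} Tjj b rewrite Tjj = xor-same (T j b)

complementAt-supported : ∀ {K} {T : Matrix k} {j} → SupportedOn K T → SupportedOn K (complementAt T j)
complementAt-supported {j = j} supported a b e = [ supported a b , supported a j ]′ (xor-∧-true _ _ _ e)

complementAt-supported-retire : ∀ {K} {T : Matrix k} {j} → SupportedOn K T → T j j ≡ true →
                                SupportedOn (K - j) (complementAt T j)
complementAt-supported-retire {T = T} {j} supported Tjj a b e with a ≟ j
... | yes refl = contradiction (trans (sym e) (complementAt-clears {T = T} Tjj b)) λ ()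
... | no a≢j   = x∈p∧x≢y⇒x∈p-y (complementAt-supported {j = j} supported a b e) a≢j

-- Complementing at j keeps j active only if T j j = 0: otherwise v_j no
-- longer represents its class afterwards.
data Reduces {k : ℕ} : Subset k → Matrix k → List (Fin k) → Set where
  cleared       : ∀ {K T} → (∀ a b → T a b ≡ false) → Reduces K T []
  complement-at : ∀ {K K′ T j js} → j ∈ K → K′ ⊆ K → (j ∈ K′ → T j j ≡ false) →
                  Reduces K′ (complementAt T j) js → Reduces K T (j ∷ js)

complement-retiring : ∀ {K} {T : Matrix k} {j js} → j ∈ K →
                      Reduces (K - j) (complementAt T j) js → Reduces K T (j ∷ js)
complement-retiring {K = K} {j = j} j∈K =
  complement-at j∈K (p─q⊆p K ⁅ j ⁆) (λ j∈K-j → contradiction j∈K-j (x∉p-x K j))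

reduces-⊆ : ∀ {K} {T : Matrix k} {js} → Reduces K T js → All (_∈ K) js
reduces-⊆ (cleared _)                      = []
reduces-⊆ (complement-at j∈K K′⊆K _ rest) = j∈K ∷ All.map K′⊆K (reduces-⊆ rest)

occ-++ : ∀ (i : Fin n) xs ys → occ i (xs ++ ys) ≡ occ i xs + occ i ys
occ-++ i xs ys = trans (cong length (filter-++ (_≟ i) xs ys)) (length-++ (filter (_≟ i) xs))

occ-absent : ∀ {i : Fin n} {xs} → All (_≢ i) xs → occ i xs ≡ 0
occ-absent {i = i} xs≢i = cong length (filter-none (_≟ i) xs≢i)

occ-++-separated : ∀ {K : Subset k} {xs ys m} → All (_∉ K) xs → All (_∈ K) ys →
                   (∀ i → occ i xs ≤ m) → (∀ i → occ i ys ≤ m) → ∀ i → occ i (xs ++ ys) ≤ m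
occ-++-separated {K = K} {xs} {ys} {m} xs∉K ys∈K xs≤m ys≤m i with i ∈? K
... | yes i∈K = begin
  occ i (xs ++ ys)     ≡⟨ occ-++ i xs ys ⟩
  occ i xs + occ i ys  ≡⟨ cong (_+ occ i ys) (occ-absent (All.map (λ x∉K x≡i → x∉K (subst (_∈ K) (sym x≡i) i∈K)) xs∉K)) ⟩
  occ i ys             ≤⟨ ys≤m i ⟩
  m                    ∎
  where open ≤-Reasoning
... | no i∉K = begin
  occ i (xs ++ ys)     ≡⟨ occ-++ i xs ys ⟩
  occ i xs + occ i ys  ≡⟨ cong (occ i xs +_) (occ-absent (All.map (λ x∈K x≡i → i∉K (subst (_∈ K) x≡i x∈K)) ys∈K)) ⟩
  occ i xs + 0         ≡⟨ +-identityʳ (occ i xs) ⟩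
  occ i xs             ≤⟨ xs≤m i ⟩
  m                    ∎
  where open ≤-Reasoning

occ-aba : ∀ {a b : Fin n} → a ≢ b → ∀ i → occ i (a ∷ b ∷ a ∷ []) ≤ 2
occ-aba {a = a} {b} a≢b i with a ≟ i
... | yes refl = s≤s (≤-trans (≤-reflexive (cong length (filter-reject (_≟ a) (a≢b ∘ sym))))
                              (length-filter (_≟ a) (a ∷ [])))
... | no _     = length-filter (_≟ i) (b ∷ a ∷ [])

occ-map≤ : ∀ {m} {f : Fin m → Fin n} {w u} → (∀ x → f x ≡ w → x ≡ u) → ∀ xs → occ w (map f xs) ≤ occ u xs
occ-map≤ f⁻¹ [] = z≤n
occ-map≤ {f = f} {w} {u} f⁻¹ (x ∷ xs) with f x ≟ w | x ≟ u
... | yes fx≡w | yes _   = s≤s (occ-map≤ f⁻¹ xs)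
... | yes fx≡w | no x≢u = contradiction (f⁻¹ x fx≡w) x≢u
... | no _     | yes _   = m≤n⇒m≤1+n (occ-map≤ f⁻¹ xs)
... | no _     | no _    = occ-map≤ f⁻¹ xs

amortised : ∀ {d m l n} → d + m ≤ n → 2 * l ≤ 3 * d → 2 * l + 3 * m ≤ 3 * n
amortised {d} {m} {l} {n} d+m≤n 2l≤3d = begin
  2 * l + 3 * m  ≤⟨ +-monoˡ-≤ (3 * m) 2l≤3d ⟩
  3 * d + 3 * m  ≡⟨ sym (*-distribˡ-+ 3 d m) ⟩
  3 * (d + m)    ≤⟨ *-monoʳ-≤ 3 d+m≤n ⟩
  3 * n          ∎
  where open ≤-Reasoning

record Reduction (K : Subset k) (T : Matrix k) : Set where
  field
    classes      : List (Fin k)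
    reduces      : Reduces K T classes
    length-bound : 2 * length classes ≤ 3 * ∣ K ∣
    occ-bound    : ∀ i → occ i classes ≤ 2

record Move (K : Subset k) (T : Matrix k) : Set where
  field
    K′          : Subset k
    T′          : Matrix k
    steps       : List (Fin k)
    shrinks     : K′ ⊂ K
    cost        : 2 * length steps + 3 * ∣ K′ ∣ ≤ 3 * ∣ K ∣
    retired     : All (_∉ K′) steps
    steps-occ   : ∀ i → occ i steps ≤ 2
    symmetric   : Symmetric T′
    supported   : SupportedOn K′ T′
    reduces-via : ∀ {js} → Reduces K′ T′ js → Reduces K T (steps ++ js)

prepend : ∀ {K} {T : Matrix k} (m : Move K T) → Reduction (Move.K′ m) (Move.T′ m) → Reduction K T
prepend {K = K} m r = record
  { classes      = steps ++ classes
  ; reduces      = reduces-via reduces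
  ; length-bound = begin
      2 * length (steps ++ classes)              ≡⟨ cong (2 *_) (length-++ steps) ⟩
      2 * (length steps + length classes)        ≡⟨ *-distribˡ-+ 2 (length steps) (length classes) ⟩
      2 * length steps + 2 * length classes      ≤⟨ +-monoʳ-≤ (2 * length steps) length-bound ⟩
      2 * length steps + 3 * ∣ K′ ∣              ≤⟨ cost ⟩
      3 * ∣ K ∣                                  ∎
  ; occ-bound    = occ-++-separated retired (reduces-⊆ reduces) steps-occ occ-bound
  }
  where
  open Move m
  open Reduction r
  open ≤-Reasoning

complement-move : ∀ {K} {T : Matrix k} {a} → Symmetric T → SupportedOn K T → T a a ≡ true → Move K T
complement-move {K = K} {T} {a} T-sym supported Taa = record
  { K′          = K - a
  ; T′          = complementAt T a
  ; steps       = a ∷ []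
  ; shrinks     = x∈p⇒p-x⊂p a∈K
  ; cost        = amortised {d = 1} {l = 1} (p⊂q⇒∣p∣<∣q∣ (x∈p⇒p-x⊂p a∈K)) (s≤s (s≤s z≤n))
  ; retired     = x∉p-x K a ∷ []
  ; steps-occ   = λ i → m≤n⇒m≤1+n (length-filter (_≟ i) (a ∷ []))
  ; symmetric   = complementAt-symmetric T-sym
  ; supported   = complementAt-supported-retire supported Taa
  ; reduces-via = complement-retiring a∈K
  }
  where
  a∈K : a ∈ K
  a∈K = supported a a Taa

-- Complementing at a makes T b b = 1, and then complementing at b makes
-- T a a = 1, so both b and a can be retired.
pivot-move : ∀ {K} {T : Matrix k} {a b} → Symmetric T → SupportedOn K T →
             T a a ≡ false → T b b ≡ false → T a b ≡ true → Move K T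
pivot-move {k = k} {K = K} {T} {a} {b} T-sym supported Taa Tbb Tab = record
  { K′          = K - b - a
  ; T′          = T₃
  ; steps       = a ∷ b ∷ a ∷ []
  ; shrinks     = ⊂-trans (x∈p⇒p-x⊂p a∈K-b) (x∈p⇒p-x⊂p b∈K)
  ; cost        = amortised {d = 2} {l = 3}
                    (≤-trans (s≤s (p⊂q⇒∣p∣<∣q∣ (x∈p⇒p-x⊂p a∈K-b))) (p⊂q⇒∣p∣<∣q∣ (x∈p⇒p-x⊂p b∈K))) ≤-refl
  ; retired     = x∉p-x (K - b) a ∷ (x∉p-x K b ∘ p─q⊆p (K - b) ⁅ a ⁆) ∷ x∉p-x (K - b) a ∷ []
  ; steps-occ   = occ-aba a≢b
  ; symmetric   = complementAt-symmetric (complementAt-symmetric (complementAt-symmetric T-sym))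
  ; supported   = complementAt-supported-retire
                    (complementAt-supported-retire (complementAt-supported supported) T₁bb) T₂aa
  ; reduces-via = complement-at a∈K ⊆-refl (λ _ → Taa) ∘ complement-retiring b∈K ∘ complement-retiring a∈K-b
  }
  where
  T₁ T₂ T₃ : Matrix k
  T₁ = complementAt T a
  T₂ = complementAt T₁ b
  T₃ = complementAt T₂ a
  Tba : T b a ≡ true
  Tba = trans (T-sym b a) Tab
  T₁bb : T₁ b b ≡ true
  T₁bb rewrite Tbb | Tba | Tab = refl
  T₂aa : T₂ a a ≡ true
  T₂aa rewrite Taa | Tba | Tab = refl
  a∈K : a ∈ K
  a∈K = supported a b Tab
  b∈K : b ∈ K
  b∈K = supported b a Tba
  a≢b : a ≢ b
  a≢b refl = contradiction (trans (sym Taa) Tab) λ ()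
  a∈K-b : a ∈ K - b
  a∈K-b = x∈p∧x≢y⇒x∈p-y a∈K a≢b

move-or-cleared : ∀ {K} {T : Matrix k} → Symmetric T → SupportedOn K T → Move K T ⊎ (∀ a b → T a b ≡ false)
move-or-cleared {T = T} T-sym supported with any? (λ a → T a a ≟ᵇ true)
... | yes (a , Taa) = inj₁ (complement-move T-sym supported Taa)
... | no no-loop with any? (λ a → any? (λ b → T a b ≟ᵇ true))
...   | yes (a , b , Tab) = inj₁ (pivot-move T-sym supported (loopless a) (loopless b) Tab)
  where
  loopless : ∀ c → T c c ≡ false
  loopless c = ¬-not (λ Tcc → no-loop (c , Tcc))
...   | no no-entry = inj₂ λ a b → ¬-not (λ Tab → no-entry (a , b , Tab))

reduce : ∀ {K} {T : Matrix k} → Symmetric T → SupportedOn K T → Acc _⊂_ K → Reduction K T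
reduce T-sym supported (acc smaller) with move-or-cleared T-sym supported
... | inj₁ m = prepend m (reduce (Move.symmetric m) (Move.supported m) (smaller (Move.shrinks m)))
... | inj₂ T≡0 = record
  { classes = [] ; reduces = cleared T≡0 ; length-bound = z≤n ; occ-bound = λ _ → z≤n }

module Simulation (G : Adj n) (G-simple : IsSimple G) (F : Flip n k) (I : Subset n)
                  (I-independent : Independent G I) (v : Fin k → Fin n)
                  (v∈I : ∀ i → v i ∈ I) (ι-v : ∀ i → ι F (v i) ≡ i) where

  Outside : Fin n → Set
  Outside x = ¬ InClosedNbhd G I x

  outside≢v : ∀ {x i} → Outside x → x ≢ v i
  outside≢v {i = i} out x≡vi = out (inj₁ (subst (_∈ I) (sym x≡vi) (v∈I i)))

  v-injective : ∀ {i i′} → i ≢ i′ → v i ≢ v i′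
  v-injective {i} {i′} i≢i′ vi≡vi′ = i≢i′ (trans (sym (ι-v i)) (trans (cong (ι F) vi≡vi′) (ι-v i′)))

  outside-nonadjacent : ∀ {x i} → Outside x → G x (v i) ≡ false
  outside-nonadjacent {x} {i} out = ¬-not λ Gxvi → out (inj₂ (v i , v∈I i , trans (IsSimple.sym G-simple (v i) x) Gxvi))

  record Represents (K : Subset k) (T : Matrix k) (H : Adj n) : Set where
    field
      simple          : IsSimple H
      symmetric       : Symmetric T
      outside-outside : ∀ {x y} → Outside x → Outside y → x ≢ y → H x y ≡ G x y xor T (ι F x) (ι F y)
      outside-v       : ∀ {x i} → Outside x → i ∈ K → H x (v i) ≡ T (ι F x) i
      v-v             : ∀ {i i′} → i ∈ K → i′ ∈ K → i ≢ i′ → H (v i) (v i′) ≡ T i i′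

  represents-flip : Represents ⊤ (τ F) (G ⊕ F)
  represents-flip = record
    { simple          = ⊕-simple G-simple F
    ; symmetric       = τsym F
    ; outside-outside = λ _ _ → ⊕-apart G F
    ; outside-v       = λ {x} {i} out _ → trans (⊕-apart G F (outside≢v out))
                          (cong₂ _xor_ (outside-nonadjacent out) (cong (τ F (ι F x)) (ι-v i)))
    ; v-v             = λ {i} {i′} _ _ i≢i′ → trans (⊕-apart G F (v-injective i≢i′))
                          (cong₂ _xor_ (I-independent (v i) (v i′) (v∈I i) (v∈I i′)) (cong₂ (τ F) (ι-v i) (ι-v i′)))
    }

  represents-complementAt : ∀ {K K′ T H j} → Represents K T H → j ∈ K → K′ ⊆ K → (j ∈ K′ → T j j ≡ false) →
                            Represents K′ (complementAt T j) (H ∗ v j)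
  represents-complementAt {K} {K′} {T} {H} {j} R j∈K K′⊆K keep = record
    { simple          = ∗-simple simple (v j)
    ; symmetric       = complementAt-symmetric symmetric
    ; outside-outside = λ {x} {y} out-x out-y x≢y → begin
        (H ∗ v j) x y                                                ≡⟨ ∗-apart H (v j) x≢y ⟩
        H x y xor (H x (v j) ∧ H (v j) y)                            ≡⟨ cong₂ _xor_ (outside-outside out-x out-y x≢y)
                                                                          (cong₂ _∧_ (outside-v out-x j∈K) (v-outside out-y)) ⟩
        (G x y xor T (ι F x) (ι F y)) xor (T (ι F x) j ∧ T j (ι F y)) ≡⟨ xor-assoc (G x y) _ _ ⟩
        G x y xor complementAt T j (ι F x) (ι F y)                   ∎
    ; outside-v       = λ {x} {i} out i∈K′ → trans (∗-apart H (v j) (outside≢v out))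
        (cong₂ _xor_ (outside-v out (K′⊆K i∈K′)) (cong₂ _∧_ (outside-v out j∈K) (vj-v i∈K′)))
    ; v-v             = λ {i} {i′} i∈K′ i′∈K′ i≢i′ → trans (∗-apart H (v j) (v-injective i≢i′))
        (cong₂ _xor_ (v-v (K′⊆K i∈K′) (K′⊆K i′∈K′) i≢i′) (cong₂ _∧_ (v-vj i∈K′) (vj-v i′∈K′)))
    }
    where
    open Represents R
    open ≡-Reasoning
    v-outside : ∀ {y} → Outside y → H (v j) y ≡ T j (ι F y)
    v-outside {y} out = trans (IsSimple.sym simple (v j) y) (trans (outside-v out j∈K) (symmetric (ι F y) j))
    v-vj : ∀ {i} → i ∈ K′ → H (v i) (v j) ≡ T i j
    v-vj {i} i∈K′ with i ≟ j
    ... | yes refl = trans (IsSimple.irref simple (v i)) (sym (keep i∈K′))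
    ... | no i≢j   = v-v (K′⊆K i∈K′) j∈K i≢j
    vj-v : ∀ {i} → i ∈ K′ → H (v j) (v i) ≡ T j i
    vj-v {i} i∈K′ = trans (IsSimple.sym simple (v j) (v i)) (trans (v-vj i∈K′) (symmetric i j))

  represents-cleared : ∀ {K T H} → Represents K T H → (∀ a b → T a b ≡ false) →
                       SameOutside (InClosedNbhd G I) H G
  represents-cleared R T≡0 x y out-x out-y with x ≟ y
  ... | yes refl = trans (IsSimple.irref (Represents.simple R) x) (sym (IsSimple.irref G-simple x))
  ... | no x≢y   = trans (Represents.outside-outside R out-x out-y x≢y)
                         (trans (cong (G x y xor_) (T≡0 (ι F x) (ι F y))) (xor-identityʳ (G x y)))

  reduces⇒sameOutside : ∀ {K T H js} → Represents K T H → Reduces K T js →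
                        SameOutside (InClosedNbhd G I) (H ∗* map v js) G
  reduces⇒sameOutside R (cleared T≡0) = represents-cleared R T≡0
  reduces⇒sameOutside R (complement-at j∈K K′⊆K keep rest) =
    reduces⇒sameOutside (represents-complementAt R j∈K K′⊆K keep) rest

lemma13 : ∀ {n k : ℕ} (G : Adj n) → IsSimple G → (F : Flip n k) → (I : Subset n) →
            Independent G I →
            (∀ (i : Fin k) → ∃ λ v → v ∈ I × ι F v ≡ i × (∀ w → w ∈ I → ι F w ≡ i → w ≡ v)) →
            ∃ λ (zs : List (Fin n)) →
              All (_∈ I) zs ×
              2 * length zs ≤ 3 * k ×
              (∀ v → occ v zs ≤ 2) ×
              SameOutside (InClosedNbhd G I) ((G ⊕ F) ∗* zs) G
lemma13 {n} {k} G G-simple F I I-independent representative =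
  map v classes , map⁺ (All.universal v∈I classes) , length-bound′ , occ-bound′ ,
  reduces⇒sameOutside represents-flip reduces
  where
  v : Fin k → Fin n
  v i = proj₁ (representative i)
  v∈I : ∀ i → v i ∈ I
  v∈I i = proj₁ (proj₂ (representative i))
  ι-v : ∀ i → ι F (v i) ≡ i
  ι-v i = proj₁ (proj₂ (proj₂ (representative i)))
  open Simulation G G-simple F I I-independent v v∈I ι-v
  open Reduction (reduce (τsym F) (λ _ _ _ → ∈⊤) (⊂-wellFounded ⊤))
  length-bound′ : 2 * length (map v classes) ≤ 3 * k
  length-bound′ = subst₂ (λ l m → 2 * l ≤ 3 * m) (sym (length-map v classes)) (∣⊤∣≡n k) length-bound
  occ-bound′ : ∀ w → occ w (map v classes) ≤ 2
  occ-bound′ w = ≤-trans (occ-map≤ (λ i vi≡w → trans (sym (ι-v i)) (cong (ι F) vi≡w)) classes) (occ-bound (ι F w))
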